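{- Let $w\in\mathfrak{S}_N$. Then $\mathrm{rep}(w)=\mathrm{rep}(\overline{w})+|\mathrm{newrep}(w)|$.
   Context: Permutations are written in one-line notation; $s_i$ is the simple reflection interchanging $i$ and $i+1$; $\ell(u)$ is the length (minimal number of simple reflections whose product is $u$); $\mathrm{supp}(u)$ is the set of distinct simple reflections appearing in a reduced decomposition of $u$ (independent of the choice); $\mathrm{rep}(u)=\ell(u)-|\mathrm{supp}(u)|$. For $w\in\mathfrak{S}_N$, $\overline{w}\in\mathfrak{S}_{N-1}$ is the permutation obtained by deleting the letter $N$ from the one-line notation of $w$: $\overline{w}(i)=w(i)$ if $i<w^{ -1}(N)$ and $\overline{w}(i)=w(i+1)$ if $i\ge w^{ -1}(N)$. Define $\mathrm{newrep}(w)=\{k:\ s_k\in\mathrm{supp}(\overline{w})\text{ and } w^{ -1}(N)\le k\}$. -}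

module Defs where

open import Data.Nat using (ℕ; zero; suc; _≤_; _<_; _∸_; _+_; _≤?_)
open import Data.Nat.Properties using () renaming (_≟_ to _≟ℕ_)
open import Data.Fin using (Fin; toℕ; fromℕ; fromℕ<)
open import Data.Fin.Permutation using (Permutation′; transpose; id; _∘ₚ_; _≈_; remove; _⟨$⟩ʳ_; _⟨$⟩ˡ_)
open import Data.List using (List; []; _∷_; length; map; filter; deduplicate)

-- A simple reflection of 𝔖_N, written 0-based: index k : Fin N with k+1 < N
-- stands for the paper's s_{k+1}, which interchanges (0-based) k and k+1.
record SimpleRefl (N : ℕ) : Set where
  constructor sr
  field
    idx : Fin N
    ok  : suc (toℕ idx) < N
open SimpleRefl public

sref : ∀ {N} → SimpleRefl N → Permutation′ N
sref g = transpose (idx g) (fromℕ< (ok g))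

Word : ℕ → Set
Word N = List (SimpleRefl N)

-- product s_{a1} s_{a2} ... s_{ak} as functions: (u v)(i) = u (v i)
-- (note (π ∘ₚ ρ) ⟨$⟩ʳ x = ρ ⟨$⟩ʳ (π ⟨$⟩ʳ x))
eval : ∀ {N} → Word N → Permutation′ N
eval []      = id
eval (g ∷ a) = eval a ∘ₚ sref g

Reduced : ∀ {N} → Word N → Permutation′ N → Set
Reduced {N} a u = eval a ≈ u × (∀ (b : Word N) → eval b ≈ u → length a ≤ length b)
  where open import Data.Product using (_×_)

suppList : ∀ {N} → Word N → List ℕ
suppList a = deduplicate _≟ℕ_ (map (λ g → toℕ (idx g)) a)

suppSize : ∀ {N} → Word N → ℕ
suppSize a = length (suppList a)

-- rep computed from a word (equals rep(u) when the word is reduced for u)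
repW : ∀ {N} → Word N → ℕ
repW a = length a ∸ suppSize a

-- w̄ : delete the letter N (0-based: fromℕ n) from the one-line notation of w
wbar : ∀ {n} → Permutation′ (suc n) → Permutation′ n
wbar {n} w = remove (w ⟨$⟩ˡ fromℕ n) w

-- 0-based position of N in w, i.e. w^{-1}(N) - 1
posN : ∀ {n} → Permutation′ (suc n) → ℕ
posN {n} w = toℕ (w ⟨$⟩ˡ fromℕ n)

-- |newrep(w)|, computed from a reduced word b of w̄:
-- number of (0-based) k in supp(w̄) with posN w ≤ k
-- (paper: 1-based k with w^{-1}(N) ≤ k; both shift by one)
newrepSize : ∀ {n} → Permutation′ (suc n) → Word n → ℕ
newrepSize w b = length (filter (λ k → posN w ≤? k) (suppList b))

-- Follow through a word for w the strand carrying the largest value n, delete the letters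
-- crossing it and renumber the others: this gives a word for w̄. Conversely
-- w = w̄ s_{n-1} ⋯ s_p with p = w⁻¹(n) (0-based), so ℓ(w) = ℓ(w̄) + (n − p); comparing
-- lengths shows that in a reduced word the strand only moves down, and that the deleted word
-- is again reduced. By induction along such deletions, a reduced word of u contains s_k
-- exactly when u does not map {0,…,k} into itself. Hence supp(w) consists of s_p, …, s_{n-1}
-- together with the s_k ∈ supp(w̄) with k < p, and counting gives the identity.
module Submission where

open import Defs
open import Data.Bool using (true; false)
open import Data.Empty using (⊥-elim)
open import Data.Fin using (Fin; toℕ; fromℕ; fromℕ<)
import Data.Fin as Fin
open import Data.Fin.Properties using (toℕ-injective; toℕ-fromℕ<; toℕ-fromℕ; toℕ<n; punchInᵢ≢i)
open import Data.Fin.Permutation using (Permutation′; _⟨$⟩ʳ_; _⟨$⟩ˡ_; _≈_; inverseʳ; inverseˡ)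
import Data.Fin.Permutation.Components as PC
open import Data.Nat using (ℕ; zero; suc; _+_; _∸_; _≤_; _<_; z≤n; s≤s; _≟_; _≤?_; _<?_)
open import Data.Nat.Properties
open import Data.List using (List; []; _∷_; length; map; _++_; filter; applyUpTo; deduplicate)
open import Data.List.Properties using (length-++; length-map; length-applyUpTo; length-deduplicate)
open import Data.List.Membership.Propositional using (_∈_; _∉_)
open import Data.List.Membership.Propositional.Properties
  using ( ∈-filter⁺; ∈-filter⁻; ∈-++⁺ˡ; ∈-++⁺ʳ; ∈-++⁻; ∈-applyUpTo⁺; ∈-applyUpTo⁻
        ; ∈-deduplicate⁺; ∈-deduplicate⁻)
open import Data.List.Membership.Propositional.Properties.WithK using (unique∧set⇒bag)
open import Data.List.Membership.DecPropositional _≟_ using (_∈?_)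
open import Data.List.Relation.Binary.BagAndSetEquality using (∼bag⇒↭)
open import Data.List.Relation.Binary.Permutation.Propositional.Properties using (↭-length)
open import Data.List.Relation.Unary.All as All using (All; []; _∷_)
import Data.List.Relation.Unary.All.Properties as All
open import Data.List.Relation.Unary.Any using (here; there)
open import Data.List.Relation.Unary.Unique.Propositional using (Unique)
open import Data.List.Relation.Unary.Unique.Propositional.Properties using (applyUpTo⁺₁)
import Data.List.Relation.Unary.Unique.Propositional.Properties as Unique
open import Data.List.Relation.Unary.Unique.DecPropositional.Properties _≟_ using (deduplicate-!)
open import Data.Product using (∃; _×_; _,_; proj₁; proj₂)
open import Data.Sum as Sum using (_⊎_; inj₁; inj₂)
open import Function using (_∘′_)
open import Function.Bundles using (_⇔_; mk⇔; Equivalence)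
open import Relation.Nullary using (¬_; yes; no; does)
open import Relation.Unary using (Pred; Decidable)
open import Relation.Unary.Properties using (∁?)
open import Relation.Binary.PropositionalEquality

-- Adjacent transpositions and punching in, on ℕ

swap : ℕ → ℕ → ℕ
swap zero    zero          = 1
swap zero    (suc zero)    = 0
swap zero    (suc (suc x)) = suc (suc x)
swap (suc g) zero          = zero
swap (suc g) (suc x)       = suc (swap g x)

swap-involutive : ∀ g x → swap g (swap g x) ≡ x
swap-involutive zero    zero          = refl
swap-involutive zero    (suc zero)    = refl
swap-involutive zero    (suc (suc x)) = refl
swap-involutive (suc g) zero          = refl
swap-involutive (suc g) (suc x)       = cong suc (swap-involutive g x)

swap-self : ∀ g → swap g g ≡ suc g
swap-self zero    = refl
swap-self (suc g) = cong suc (swap-self g)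

swap-suc-self : ∀ g → swap g (suc g) ≡ g
swap-suc-self g = trans (cong (swap g) (sym (swap-self g))) (swap-involutive g g)

swap-other : ∀ {g x} → x ≢ g → x ≢ suc g → swap g x ≡ x
swap-other {zero}  {zero}        x≢g _    = ⊥-elim (x≢g refl)
swap-other {zero}  {suc zero}    _   x≢1  = ⊥-elim (x≢1 refl)
swap-other {zero}  {suc (suc x)} _   _    = refl
swap-other {suc g} {zero}        _   _    = refl
swap-other {suc g} {suc x}       x≢g x≢sg = cong suc (swap-other (x≢g ∘′ cong suc) (x≢sg ∘′ cong suc))

swap-below : ∀ {g x} → x < g → swap g x ≡ x
swap-below x<g = swap-other (<⇒≢ x<g) (<⇒≢ (m<n⇒m<1+n x<g))

swap-above : ∀ {g x} → suc g < x → swap g x ≡ x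
swap-above sg<x = swap-other (≢-sym (<⇒≢ (<-trans (n<1+n _) sg<x))) (≢-sym (<⇒≢ sg<x))

swap-< : ∀ {g x N} → suc g < N → x < N → swap g x < N
swap-< {zero}  {zero}        1<N _   = 1<N
swap-< {zero}  {suc zero}    1<N _   = <-trans (n<1+n 0) 1<N
swap-< {zero}  {suc (suc x)} _   x<N = x<N
swap-< {suc g} {zero}        _   x<N = x<N
swap-< {suc g} {suc x} {suc N} g<N x<N = s≤s (swap-< (≤-pred g<N) (≤-pred x<N))

swap-≤ : ∀ {g k x} → g ≢ k → x ≤ k → swap g x ≤ k
swap-≤ {zero}  {x = zero}        g≢k _   = ≤∧≢⇒< z≤n g≢k
swap-≤ {zero}  {x = suc zero}    _   _   = z≤n
swap-≤ {zero}  {x = suc (suc x)} _   x≤k = x≤k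
swap-≤ {suc g} {x = zero}        _   _   = z≤n
swap-≤ {suc g} {suc k} {suc x}   g≢k x≤k = s≤s (swap-≤ (g≢k ∘′ cong suc) (≤-pred x≤k))

punchIn : ℕ → ℕ → ℕ
punchIn zero    x       = suc x
punchIn (suc p) zero    = zero
punchIn (suc p) (suc x) = suc (punchIn p x)

punchIn-< : ∀ {p x} → x < p → punchIn p x ≡ x
punchIn-< {suc p} {zero}  _   = refl
punchIn-< {suc p} {suc x} x<p = cong suc (punchIn-< (≤-pred x<p))

punchIn-≥ : ∀ {p x} → p ≤ x → punchIn p x ≡ suc x
punchIn-≥ {zero}          _   = refl
punchIn-≥ {suc p} {suc x} p≤x = cong suc (punchIn-≥ (≤-pred p≤x))

punchIn-surjective : ∀ {p n x} → p ≤ n → x < suc n → x ≢ p → ∃ λ y → y < n × punchIn p y ≡ x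
punchIn-surjective {zero}          {x = zero}  _   _   x≢p = ⊥-elim (x≢p refl)
punchIn-surjective {zero}          {x = suc y} _   x<n _   = y , ≤-pred x<n , refl
punchIn-surjective {suc p} {suc n} {zero}      _   _   _   = zero , s≤s z≤n , refl
punchIn-surjective {suc p} {suc n} {suc x}     p≤n x<n x≢p
  with y , y<n , eq ← punchIn-surjective (≤-pred p≤n) (≤-pred x<n) (x≢p ∘′ cong suc)
  = suc y , s≤s y<n , cong suc eq

swap-punchIn-suc : ∀ g y → swap g (punchIn (suc g) y) ≡ punchIn g y
swap-punchIn-suc zero    zero    = refl
swap-punchIn-suc zero    (suc y) = refl
swap-punchIn-suc (suc g) zero    = refl
swap-punchIn-suc (suc g) (suc y) = cong suc (swap-punchIn-suc g y)

swap-punchIn : ∀ g y → swap g (punchIn g y) ≡ punchIn (suc g) y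
swap-punchIn g y = begin
  swap g (punchIn g y)                 ≡⟨ cong (swap g) (swap-punchIn-suc g y) ⟨
  swap g (swap g (punchIn (suc g) y))  ≡⟨ swap-involutive g _ ⟩
  punchIn (suc g) y                    ∎
  where open ≡-Reasoning

swap-punchIn-above : ∀ {g p} y → suc g < p → swap g (punchIn p y) ≡ punchIn p (swap g y)
swap-punchIn-above {zero}  zero          (s≤s (s≤s _)) = refl
swap-punchIn-above {zero}  (suc zero)    (s≤s (s≤s _)) = refl
swap-punchIn-above {zero}  (suc (suc y)) (s≤s (s≤s _)) = refl
swap-punchIn-above {suc g} zero          (s≤s _)       = refl
swap-punchIn-above {suc g} (suc y)       (s≤s g<p)     = cong suc (swap-punchIn-above y g<p)

swap-punchIn-below : ∀ {h p} y → p ≤ h → swap (suc h) (punchIn p y) ≡ punchIn p (swap h y)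
swap-punchIn-below {h}     {zero}  y       _   = refl
swap-punchIn-below {suc h} {suc p} zero    _   = refl
swap-punchIn-below {suc h} {suc p} (suc y) p≤h = cong suc (swap-punchIn-below y (≤-pred p≤h))

-- Words acting on ℕ

act : List ℕ → ℕ → ℕ
act []      x = x
act (g ∷ c) x = swap g (act c x)

Bounded : ℕ → List ℕ → Set
Bounded N = All (λ g → suc g < N)

act-++ : ∀ c d x → act (c ++ d) x ≡ act c (act d x)
act-++ []      d x = refl
act-++ (g ∷ c) d x = cong (swap g) (act-++ c d x)

act-injective : ∀ c {x y} → act c x ≡ act c y → x ≡ y
act-injective []      eq = eq
act-injective (g ∷ c) {x} {y} eq = act-injective c (begin
  act c x                    ≡⟨ swap-involutive g _ ⟨
  swap g (swap g (act c x))  ≡⟨ cong (swap g) eq ⟩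
  swap g (swap g (act c y))  ≡⟨ swap-involutive g _ ⟩
  act c y                    ∎)
  where open ≡-Reasoning

act-< : ∀ {N c x} → Bounded N c → x < N → act c x < N
act-< []         x<N = x<N
act-< (g<N ∷ bc) x<N = swap-< g<N (act-< bc x<N)

act-fixed : ∀ {N c x} → Bounded N c → N ≤ x → act c x ≡ x
act-fixed []                      _   = refl
act-fixed {c = g ∷ c} (g<N ∷ bc) N≤x =
  trans (cong (swap g) (act-fixed bc N≤x)) (swap-above (<-≤-trans g<N N≤x))

Agree : ℕ → List ℕ → List ℕ → Set
Agree N c c′ = ∀ x → x < N → act c x ≡ act c′ x

IsReduced : ℕ → List ℕ → Set
IsReduced N c = Bounded N c × (∀ c′ → Bounded N c′ → Agree N c c′ → length c ≤ length c′)

reduced-length-unique : ∀ {N c c′} → IsReduced N c → IsReduced N c′ → Agree N c c′ →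
                        length c ≡ length c′
reduced-length-unique (bc , c-minimal) (bc′ , c′-minimal) agree =
  ≤-antisym (c-minimal _ bc′ agree) (c′-minimal _ bc (λ x x<N → sym (agree x x<N)))

-- Following a strand

data Crossing : ℕ → ℕ → Set where
  rise  : ∀ g → Crossing g g
  fall  : ∀ g → Crossing (suc g) g
  above : ∀ {p g} → suc g < p → Crossing p g
  below : ∀ {p h} → p ≤ h → Crossing p (suc h)

crossing : ∀ p g → Crossing p g
crossing zero          zero    = rise zero
crossing zero          (suc h) = below z≤n
crossing (suc zero)    zero    = fall zero
crossing (suc (suc p)) zero    = above (s≤s (s≤s z≤n))
crossing (suc p)       (suc g) = shift (crossing p g)
  where
  shift : ∀ {p g} → Crossing p g → Crossing (suc p) (suc g)
  shift (rise g)   = rise (suc g)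
  shift (fall g)   = fall (suc g)
  shift (above lt) = above (s≤s lt)
  shift (below le) = below (s≤s le)

record Strand : Set where
  constructor strand
  field
    residue : List ℕ
    origin  : ℕ
    rises   : ℕ
    falls   : ℕ

-- Follow, from the outermost letter inwards, the strand that ends at position p: the
-- letters crossing it are deleted and counted, the others are renumbered as letters of
-- the word with that strand removed.
follow : ℕ → List ℕ → Strand
follow p []      = strand [] p 0 0
follow p (g ∷ c) with crossing p g
... | rise g          = let s = follow (suc g) c in record s { rises = suc (Strand.rises s) }
... | fall g          = let s = follow g c in record s { falls = suc (Strand.falls s) }
... | above {g = g} _ = let s = follow p c in record s { residue = g ∷ Strand.residue s }
... | below {h = h} _ = let s = follow p c in record s { residue = h ∷ Strand.residue s }

follow-punchIn : ∀ p c y → let open Strand (follow p c) in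
                 act c (punchIn origin y) ≡ punchIn p (act residue y)
follow-punchIn p []      y = refl
follow-punchIn p (g ∷ c) y with crossing p g
... | rise g     = trans (cong (swap g) (follow-punchIn (suc g) c y)) (swap-punchIn-suc g _)
... | fall g     = trans (cong (swap g) (follow-punchIn g c y)) (swap-punchIn g _)
... | above lt   = trans (cong (swap g) (follow-punchIn p c y)) (swap-punchIn-above _ lt)
... | below {h = h} le =
  trans (cong (swap (suc h)) (follow-punchIn p c y)) (swap-punchIn-below _ le)

follow-origin : ∀ p c → act c (Strand.origin (follow p c)) ≡ p
follow-origin p []      = refl
follow-origin p (g ∷ c) with crossing p g
... | rise g   = trans (cong (swap g) (follow-origin (suc g) c)) (swap-suc-self g)
... | fall g   = trans (cong (swap g) (follow-origin g c)) (swap-self g)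
... | above lt = trans (cong (swap g) (follow-origin p c)) (swap-above lt)
... | below le = trans (cong (swap _) (follow-origin p c)) (swap-below (s≤s le))

follow-length : ∀ p c → let open Strand (follow p c) in length c ≡ length residue + (rises + falls)
follow-length p []      = refl
follow-length p (g ∷ c) with crossing p g
... | rise g  = trans (cong suc (follow-length (suc g) c)) (sym (+-suc _ _))
... | fall g  = trans (cong suc (follow-length g c))
                      (sym (trans (cong (length (Strand.residue (follow g c)) +_) (+-suc _ _)) (+-suc _ _)))
... | above _ = cong suc (follow-length p c)
... | below _ = cong suc (follow-length p c)

follow-balance : ∀ p c → let open Strand (follow p c) in origin + falls ≡ p + rises
follow-balance p []      = refl
follow-balance p (g ∷ c) with crossing p g
... | rise g  = trans (follow-balance (suc g) c) (sym (+-suc g _))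
... | fall g  = trans (+-suc _ _) (cong suc (follow-balance g c))
... | above _ = follow-balance p c
... | below _ = follow-balance p c

follow-bounded : ∀ {n p c} → p ≤ n → Bounded (suc n) c → Bounded n (Strand.residue (follow p c))
follow-bounded {c = []}        _   []         = []
follow-bounded {n} {p} {g ∷ c} p≤n (g<n ∷ bc) with crossing p g
... | rise g   = follow-bounded (≤-pred g<n) bc
... | fall g   = follow-bounded (≤-trans (n≤1+n g) p≤n) bc
... | above lt = <-≤-trans lt p≤n ∷ follow-bounded p≤n bc
... | below _  = ≤-pred g<n ∷ follow-bounded p≤n bc

origin-≤-of-no-rises : ∀ p c → let open Strand (follow p c) in rises ≡ 0 → origin ≤ p
origin-≤-of-no-rises p c r≡0 = begin
  origin          ≤⟨ m≤m+n origin falls ⟩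
  origin + falls  ≡⟨ follow-balance p c ⟩
  p + rises       ≡⟨ cong (p +_) r≡0 ⟩
  p + 0           ≡⟨ +-identityʳ p ⟩
  p               ∎
  where
  open Strand (follow p c)
  open ≤-Reasoning

-- Without rises the strand only moves down, so no letter below the origin crosses it.
follow-keeps-below : ∀ p c → let open Strand (follow p c) in
                     rises ≡ 0 → ∀ {k} → k ∈ c → k < origin → k ∈ residue
follow-keeps-below p (g ∷ c) r≡0 k∈ k<o with crossing p g
follow-keeps-below p (g ∷ c) ()  k∈          k<o | rise g
follow-keeps-below p (g ∷ c) r≡0 (here refl) k<o | fall g =
  ⊥-elim (<-irrefl refl (<-≤-trans k<o (origin-≤-of-no-rises g c r≡0)))
follow-keeps-below p (g ∷ c) r≡0 (there k∈)  k<o | fall g = follow-keeps-below g c r≡0 k∈ k<o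
follow-keeps-below p (g ∷ c) r≡0 (here refl) k<o | above _ = here refl
follow-keeps-below p (g ∷ c) r≡0 (there k∈)  k<o | above _ = there (follow-keeps-below p c r≡0 k∈ k<o)
follow-keeps-below p (g ∷ c) r≡0 (here refl) k<o | below le =
  ⊥-elim (<-irrefl refl (<-≤-trans k<o (≤-trans (origin-≤-of-no-rises p c r≡0) (m≤n⇒m≤1+n le))))
follow-keeps-below p (g ∷ c) r≡0 (there k∈)  k<o | below _ = there (follow-keeps-below p c r≡0 k∈ k<o)

-- Deleting and reinserting a strand

climb : ℕ → ℕ → List ℕ
climb p zero    = []
climb p (suc k) = p + k ∷ climb p k

length-climb : ∀ p k → length (climb p k) ≡ k
length-climb p zero    = refl
length-climb p (suc k) = cong suc (length-climb p k)

climb-bounded : ∀ p k → Bounded (suc (p + k)) (climb p k)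
climb-bounded p zero    = []
climb-bounded p (suc k) = s≤s (≤-reflexive (sym (+-suc p k)))
                        ∷ All.map (λ lt → ≤-trans lt (s≤s (+-monoʳ-≤ p (n≤1+n k)))) (climb-bounded p k)

act-climb-start : ∀ p k → act (climb p k) p ≡ p + k
act-climb-start p zero    = sym (+-identityʳ p)
act-climb-start p (suc k) = begin
  swap (p + k) (act (climb p k) p)  ≡⟨ cong (swap (p + k)) (act-climb-start p k) ⟩
  swap (p + k) (p + k)              ≡⟨ swap-self (p + k) ⟩
  suc (p + k)                       ≡⟨ +-suc p k ⟨
  p + suc k                         ∎
  where open ≡-Reasoning

act-climb-punchIn : ∀ p k {y} → y < p + k → act (climb p k) (punchIn p y) ≡ y
act-climb-punchIn p zero    y<p = punchIn-< (subst (_ <_) (+-identityʳ p) y<p)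
act-climb-punchIn p (suc k) {y} y<p+sk with m<1+n⇒m<n∨m≡n (subst (y <_) (+-suc p k) y<p+sk)
... | inj₁ y<p+k = trans (cong (swap (p + k)) (act-climb-punchIn p k y<p+k)) (swap-below y<p+k)
... | inj₂ refl  = begin
  swap (p + k) (act (climb p k) (punchIn p (p + k)))
    ≡⟨ cong (λ x → swap (p + k) (act (climb p k) x)) (punchIn-≥ (m≤m+n p k)) ⟩
  swap (p + k) (act (climb p k) (suc (p + k)))
    ≡⟨ cong (swap (p + k)) (act-fixed (climb-bounded p k) ≤-refl) ⟩
  swap (p + k) (suc (p + k))
    ≡⟨ swap-suc-self (p + k) ⟩
  p + k
    ∎
  where open ≡-Reasoning

-- d acts on {0,…,n-1} as c acts on {0,…,n} with the strand starting at p removed.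
Deletion : ℕ → ℕ → List ℕ → List ℕ → Set
Deletion n p c d = ∀ y → y < n → act d y ≡ act c (punchIn p y)

deletion-agrees-below : ∀ {n p} c d → p ≤ n → Deletion n p c d → ∀ {x} → x < p → act d x ≡ act c x
deletion-agrees-below c d p≤n del {x} x<p = trans (del x (<-≤-trans x<p p≤n)) (cong (act c) (punchIn-< x<p))

reinsertion-bounded : ∀ {n p d} → p ≤ n → Bounded n d → Bounded (suc n) (d ++ climb p (n ∸ p))
reinsertion-bounded {n} {p} p≤n bd = All.++⁺ (All.map m<n⇒m<1+n bd)
  (subst (λ m → Bounded (suc m) (climb p (n ∸ p))) (m+[n∸m]≡n p≤n) (climb-bounded p (n ∸ p)))

reinsert-strand : ∀ {n p} c {d} → p ≤ n → act c p ≡ n → Bounded n d → Deletion n p c d →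
                  Agree (suc n) c (d ++ climb p (n ∸ p))
reinsert-strand {n} {p} c {d} p≤n cp≡n bd del x x<sn with x ≟ p
... | yes refl = begin
  act c x                           ≡⟨ cp≡n ⟩
  n                                 ≡⟨ act-fixed bd ≤-refl ⟨
  act d n                           ≡⟨ cong (act d) (trans (act-climb-start p (n ∸ p)) (m+[n∸m]≡n p≤n)) ⟨
  act d (act (climb p (n ∸ p)) p)   ≡⟨ act-++ d _ p ⟨
  act (d ++ climb p (n ∸ p)) x      ∎
  where open ≡-Reasoning
... | no x≢p with y , y<n , refl ← punchIn-surjective p≤n x<sn x≢p = begin
  act c (punchIn p y)                          ≡⟨ del y y<n ⟨
  act d y                                      ≡⟨ cong (act d) (act-climb-punchIn p (n ∸ p) y<p+[n∸p]) ⟨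
  act d (act (climb p (n ∸ p)) (punchIn p y))  ≡⟨ act-++ d _ _ ⟨
  act (d ++ climb p (n ∸ p)) (punchIn p y)     ∎
  where
  open ≡-Reasoning
  y<p+[n∸p] : y < p + (n ∸ p)
  y<p+[n∸p] = subst (y <_) (sym (m+[n∸m]≡n p≤n)) y<n

module TopStrand {n c} (bc : Bounded (suc n) c) where

  open Strand (follow n c) public

  origin-≤ : origin ≤ n
  origin-≤ with origin ≤? n
  ... | yes o≤n = o≤n
  ... | no  o≰n = ⊥-elim (<-irrefl (trans (sym (follow-origin n c)) (act-fixed bc (≰⇒> o≰n))) (≰⇒> o≰n))

  residue-bounded : Bounded n residue
  residue-bounded = follow-bounded ≤-refl bc

  residue-deletion : Deletion n origin c residue
  residue-deletion y y<n = sym (trans (follow-punchIn n c y) (punchIn-< (act-< residue-bounded y<n)))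

  length-≥ : length residue + (n ∸ origin) ≤ length c
  length-≥ = begin
    length residue + (n ∸ origin)     ≤⟨ +-monoʳ-≤ (length residue) crossings-≥ ⟩
    length residue + (rises + falls)  ≡⟨ follow-length n c ⟨
    length c                          ∎
    where
    open ≤-Reasoning
    crossings-≥ : n ∸ origin ≤ rises + falls
    crossings-≥ = begin
      n ∸ origin               ≤⟨ ∸-monoˡ-≤ origin (m≤n+m n rises) ⟩
      rises + n ∸ origin       ≡⟨ cong (_∸ origin) (+-comm rises n) ⟩
      n + rises ∸ origin       ≡⟨ cong (_∸ origin) (follow-balance n c) ⟨
      origin + falls ∸ origin  ≡⟨ m+n∸m≡n origin falls ⟩
      falls                    ≤⟨ m≤n+m falls rises ⟩
      rises + falls            ∎

  module _ (rc : IsReduced (suc n) c) where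

    length-≤ : ∀ {b} → Bounded n b → Deletion n origin c b → length c ≤ length b + (n ∸ origin)
    length-≤ {b} bb del = begin
      length c
        ≤⟨ proj₂ rc _ (reinsertion-bounded origin-≤ bb) (reinsert-strand c origin-≤ (follow-origin n c) bb del) ⟩
      length (b ++ climb origin (n ∸ origin))
        ≡⟨ length-++ b ⟩
      length b + length (climb origin (n ∸ origin))
        ≡⟨ cong (length b +_) (length-climb origin (n ∸ origin)) ⟩
      length b + (n ∸ origin)
        ∎
      where open ≤-Reasoning

    length-reduced : length c ≡ length residue + (n ∸ origin)
    length-reduced = ≤-antisym (length-≤ residue-bounded residue-deletion) length-≥

    residue-reduced : IsReduced n residue
    residue-reduced = residue-bounded , λ b bb agree →
      +-cancelʳ-≤ (n ∸ origin) (length residue) (length b)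
        (≤-trans (≤-reflexive (sym length-reduced))
                 (length-≤ bb (λ y y<n → trans (sym (agree y y<n)) (residue-deletion y y<n))))

    no-rises : rises ≡ 0
    no-rises = m+n≡0⇒m≡0 rises (+-cancelˡ-≡ n (rises + rises) 0 (begin
      n + (rises + rises)       ≡⟨ +-assoc n rises rises ⟨
      n + rises + rises         ≡⟨ cong (_+ rises) (follow-balance n c) ⟨
      origin + falls + rises    ≡⟨ +-assoc origin falls rises ⟩
      origin + (falls + rises)  ≡⟨ cong (origin +_) (+-comm falls rises) ⟩
      origin + (rises + falls)  ≡⟨ cong (origin +_) crossings-≡ ⟩
      origin + (n ∸ origin)     ≡⟨ m+[n∸m]≡n origin-≤ ⟩
      n                         ≡⟨ +-identityʳ n ⟨
      n + 0                     ∎))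
      where
      open ≡-Reasoning
      crossings-≡ : rises + falls ≡ n ∸ origin
      crossings-≡ = +-cancelˡ-≡ (length residue) _ _ (trans (sym (follow-length n c)) length-reduced)

-- The support of a reduced word

Stabilises : (ℕ → ℕ) → ℕ → Set
Stabilises f k = ∀ x → x ≤ k → f x ≤ k

stabilises-cong : ∀ {f g k} → (∀ x → x ≤ k → f x ≡ g x) → Stabilises f k → Stabilises g k
stabilises-cong f≗g stable x x≤k = subst (_≤ _) (f≗g x x≤k) (stable x x≤k)

absent⇒stabilises : ∀ c {k} → k ∉ c → Stabilises (act c) k
absent⇒stabilises []      _   x x≤k = x≤k
absent⇒stabilises (g ∷ c) k∉c x x≤k =
  swap-≤ (λ g≡k → k∉c (here (sym g≡k))) (absent⇒stabilises c (k∉c ∘′ there) x x≤k)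

unstable⇒present : ∀ c {k} → ¬ Stabilises (act c) k → k ∈ c
unstable⇒present c {k} unstable with k ∈? c
... | yes k∈c = k∈c
... | no  k∉c = ⊥-elim (unstable (absent⇒stabilises c k∉c))

-- The top strand starts at the origin, which a stable prefix {0,…,k} cannot contain;
-- so k survives in the reduced residue, on which the prefix is still stable.
present⇒unstable : ∀ N c → IsReduced N c → ∀ {k} → k ∈ c → ¬ Stabilises (act c) k
present⇒unstable zero    c (bc , _) k∈c _ with () ← All.lookup bc k∈c
present⇒unstable (suc n) c rc {k} k∈c stable =
  present⇒unstable n residue (residue-reduced rc) k∈residue residue-stable
  where
  open TopStrand (proj₁ rc)
  k<n : k < n
  k<n = ≤-pred (All.lookup (proj₁ rc) k∈c)
  k<origin : k < origin
  k<origin with k <? origin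
  ... | yes k<o = k<o
  ... | no  k≮o = ⊥-elim (<⇒≱ k<n (subst (_≤ k) (follow-origin n c) (stable origin (≮⇒≥ k≮o))))
  k∈residue : k ∈ residue
  k∈residue = follow-keeps-below n c (no-rises rc) k∈c k<origin
  residue-stable : Stabilises (act residue) k
  residue-stable = stabilises-cong
    (λ x x≤k → sym (deletion-agrees-below c residue origin-≤ residue-deletion (≤-<-trans x≤k k<origin)))
    stable

module DeleteTopStrand {n a b p} (ra : IsReduced (suc n) a) (rb : IsReduced n b)
                       (p≤n : p ≤ n) (ap≡n : act a p ≡ n) (del : Deletion n p a b) where

  open TopStrand (proj₁ ra)

  origin≡p : origin ≡ p
  origin≡p = act-injective a (trans (follow-origin n a) (sym ap≡n))

  length-deleted : length a ≡ length b + (n ∸ p)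
  length-deleted = trans (length-reduced ra)
    (cong₂ (λ ℓ q → ℓ + (n ∸ q)) (reduced-length-unique (residue-reduced ra) rb residue≈b) origin≡p)
    where
    residue≈b : Agree n residue b
    residue≈b y y<n = trans (residue-deletion y y<n)
      (trans (cong (λ q → act a (punchIn q y)) origin≡p) (sym (del y y<n)))

  agree-below : ∀ {k} → k < p → ∀ x → x ≤ k → act b x ≡ act a x
  agree-below k<p x x≤k = deletion-agrees-below a b p≤n del (≤-<-trans x≤k k<p)

  -- Below p the two words act alike; from p on, {0,…,k} contains p, which a sends to n.
  support-deleted : ∀ k → k ∈ a ⇔ (p ≤ k × k < n ⊎ k < p × k ∈ b)
  support-deleted k = mk⇔ to from
    where
    to : k ∈ a → p ≤ k × k < n ⊎ k < p × k ∈ b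
    to k∈a with p ≤? k
    ... | yes p≤k = inj₁ (p≤k , ≤-pred (All.lookup (proj₁ ra) k∈a))
    ... | no  p≰k = inj₂ (≰⇒> p≰k , unstable⇒present b
                     (present⇒unstable (suc n) a ra k∈a ∘′ stabilises-cong (agree-below (≰⇒> p≰k))))
    from : p ≤ k × k < n ⊎ k < p × k ∈ b → k ∈ a
    from (inj₁ (p≤k , k<n)) = unstable⇒present a λ stable → <⇒≱ k<n (subst (_≤ k) ap≡n (stable p p≤k))
    from (inj₂ (k<p , k∈b)) = unstable⇒present a
      (present⇒unstable n b rb k∈b ∘′ stabilises-cong (λ x x≤k → sym (agree-below k<p x x≤k)))

length-filter-∁ : ∀ {a p} {A : Set a} {P : Pred A p} (P? : Decidable P) xs →
                  length (filter P? xs) + length (filter (∁? P?) xs) ≡ length xs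
length-filter-∁ P? []       = refl
length-filter-∁ P? (x ∷ xs) with does (P? x)
... | true  = cong suc (length-filter-∁ P? xs)
... | false = trans (+-suc _ _) (cong suc (length-filter-∁ P? xs))

length-unique : ∀ {a} {A : Set a} {xs ys : List A} → Unique xs → Unique ys →
                (∀ {x} → x ∈ xs ⇔ x ∈ ys) → length xs ≡ length ys
length-unique xs! ys! same = ↭-length (∼bag⇒↭ (unique∧set⇒bag xs! ys! same))

range : ℕ → ℕ → List ℕ
range p n = applyUpTo (p +_) (n ∸ p)

length-range : ∀ p n → length (range p n) ≡ n ∸ p
length-range p n = length-applyUpTo (p +_) (n ∸ p)

range-unique : ∀ p n → Unique (range p n)
range-unique p n = applyUpTo⁺₁ (p +_) (n ∸ p) (λ i<j _ eq → <⇒≢ i<j (+-cancelˡ-≡ p _ _ eq))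

∈-range : ∀ {p n k} → p ≤ n → k ∈ range p n ⇔ (p ≤ k × k < n)
∈-range {p} {n} {k} p≤n = mk⇔ to from
  where
  to : k ∈ range p n → p ≤ k × k < n
  to k∈ with i , i<n∸p , refl ← ∈-applyUpTo⁻ (p +_) k∈ =
    m≤m+n p i , subst (p + i <_) (m+[n∸m]≡n p≤n) (+-monoʳ-< p i<n∸p)
  from : p ≤ k × k < n → k ∈ range p n
  from (p≤k , k<n) = subst (_∈ range p n) (m+[n∸m]≡n p≤k) (∈-applyUpTo⁺ (p +_) (∸-monoˡ-< k<n p≤k))

length-support : ∀ {p n} as bs → p ≤ n → (∀ k → k ∈ as ⇔ (p ≤ k × k < n ⊎ k < p × k ∈ bs)) →
                 length (deduplicate _≟_ as) ≡ (n ∸ p) + length (filter (∁? (p ≤?_)) (deduplicate _≟_ bs))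
length-support {p} {n} as bs p≤n support = begin
  length (deduplicate _≟_ as)      ≡⟨ length-unique (deduplicate-! as) range++low-unique same-members ⟩
  length (range p n ++ low)        ≡⟨ length-++ (range p n) ⟩
  length (range p n) + length low  ≡⟨ cong (_+ length low) (length-range p n) ⟩
  (n ∸ p) + length low             ∎
  where
  open ≡-Reasoning
  low : List ℕ
  low = filter (∁? (p ≤?_)) (deduplicate _≟_ bs)
  ∈-low : ∀ {k} → k ∈ low ⇔ (k < p × k ∈ bs)
  ∈-low {k} = mk⇔ to from
    where
    to : k ∈ low → k < p × k ∈ bs
    to k∈low with k∈ , p≰k ← ∈-filter⁻ (∁? (p ≤?_)) {xs = deduplicate _≟_ bs} k∈low =
      ≰⇒> p≰k , ∈-deduplicate⁻ _≟_ bs k∈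
    from : k < p × k ∈ bs → k ∈ low
    from (k<p , k∈bs) = ∈-filter⁺ (∁? (p ≤?_)) (∈-deduplicate⁺ _≟_ k∈bs) (<⇒≱ k<p)
  range++low-unique : Unique (range p n ++ low)
  range++low-unique = Unique.++⁺ (range-unique p n) (Unique.filter⁺ _ (deduplicate-! bs))
    λ (k∈range , k∈low) → <⇒≱ (proj₁ (Equivalence.to ∈-low k∈low)) (proj₁ (Equivalence.to (∈-range p≤n) k∈range))
  same-members : ∀ {k} → k ∈ deduplicate _≟_ as ⇔ k ∈ range p n ++ low
  same-members {k} = mk⇔
    (λ k∈ → Sum.[ ∈-++⁺ˡ ∘′ Equivalence.from (∈-range p≤n) , ∈-++⁺ʳ (range p n) ∘′ Equivalence.from ∈-low ]′
              (Equivalence.to (support k) (∈-deduplicate⁻ _≟_ as k∈)))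
    (λ k∈ → ∈-deduplicate⁺ _≟_ (Equivalence.from (support k)
              (Sum.map (Equivalence.to (∈-range p≤n)) (Equivalence.to ∈-low) (∈-++⁻ (range p n) k∈))))

[m+o]∸[o+n]≡m∸[k+n]+k : ∀ m n o k → k + n ≤ m → (m + o) ∸ (o + n) ≡ m ∸ (k + n) + k
[m+o]∸[o+n]≡m∸[k+n]+k m n o k k+n≤m = begin
  (m + o) ∸ (o + n)  ≡⟨ cong (_∸ (o + n)) (+-comm m o) ⟩
  (o + m) ∸ (o + n)  ≡⟨ [m+n]∸[m+o]≡n∸o o m n ⟩
  m ∸ n              ≡⟨ m∸n+n≡m (m+n≤o⇒m≤o∸n k k+n≤m) ⟨
  m ∸ n ∸ k + k      ≡⟨ cong (_+ k) (trans (∸-+-assoc m n k) (cong (m ∸_) (+-comm n k))) ⟩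
  m ∸ (k + n) + k    ∎
  where open ≡-Reasoning

-- From permutations of Fin to words on ℕ

indices : ∀ {N} → Word N → List ℕ
indices = map (λ g → toℕ (idx g))

toℕ-transpose-adjacent : ∀ {N} (i j k : Fin N) → toℕ j ≡ suc (toℕ i) →
                         toℕ (PC.transpose i j k) ≡ swap (toℕ i) (toℕ k)
toℕ-transpose-adjacent i j k j≡1+i with k Fin.≟ i
... | yes refl = trans j≡1+i (sym (swap-self (toℕ i)))
... | no  k≢i with k Fin.≟ j
...   | yes refl = sym (trans (cong (swap (toℕ i)) j≡1+i) (swap-suc-self (toℕ i)))
...   | no  k≢j =
  sym (swap-other (k≢i ∘′ toℕ-injective) (k≢j ∘′ toℕ-injective ∘′ (λ e → trans e (sym j≡1+i))))

toℕ-eval : ∀ {N} (a : Word N) i → toℕ (eval a ⟨$⟩ʳ i) ≡ act (indices a) (toℕ i)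
toℕ-eval []      i = refl
toℕ-eval (g ∷ a) i = trans (toℕ-transpose-adjacent (idx g) _ _ (toℕ-fromℕ< (ok g)))
                           (cong (swap (toℕ (idx g))) (toℕ-eval a i))

indices-bounded : ∀ {N} (a : Word N) → Bounded N (indices a)
indices-bounded []      = []
indices-bounded (g ∷ a) = ok g ∷ indices-bounded a

fromIndices : ∀ {N} c → Bounded N c → Word N
fromIndices []      []         = []
fromIndices (g ∷ c) (g<N ∷ bc) =
  sr (fromℕ< (<-trans (n<1+n g) g<N)) (subst (λ m → suc m < _) (sym (toℕ-fromℕ< _)) g<N) ∷ fromIndices c bc

indices-fromIndices : ∀ {N} c (bc : Bounded N c) → indices (fromIndices c bc) ≡ c
indices-fromIndices []      []         = refl
indices-fromIndices (g ∷ c) (g<N ∷ bc) = cong₂ _∷_ (toℕ-fromℕ< _) (indices-fromIndices c bc)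

indices-reduced : ∀ {N} (a : Word N) {u} → Reduced a u → IsReduced N (indices a)
indices-reduced {N} a {u} (a≈u , minimal) = indices-bounded a , λ c bc agree →
  subst₂ _≤_ (sym (length-map _ a))
    (trans (sym (length-map _ (fromIndices c bc))) (cong length (indices-fromIndices c bc)))
    (minimal (fromIndices c bc) (λ i → toℕ-injective (begin
      toℕ (eval (fromIndices c bc) ⟨$⟩ʳ i)      ≡⟨ toℕ-eval (fromIndices c bc) i ⟩
      act (indices (fromIndices c bc)) (toℕ i)  ≡⟨ cong (λ c′ → act c′ (toℕ i)) (indices-fromIndices c bc) ⟩
      act c (toℕ i)                             ≡⟨ agree (toℕ i) (toℕ<n i) ⟨
      act (indices a) (toℕ i)                   ≡⟨ toℕ-eval a i ⟨
      toℕ (eval a ⟨$⟩ʳ i)                       ≡⟨ cong toℕ (a≈u i) ⟩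
      toℕ (u ⟨$⟩ʳ i)                            ∎)))
  where open ≡-Reasoning

toℕ-punchIn : ∀ {m} (i : Fin (suc m)) j → toℕ (Fin.punchIn i j) ≡ punchIn (toℕ i) (toℕ j)
toℕ-punchIn Fin.zero    j           = refl
toℕ-punchIn (Fin.suc i) Fin.zero    = refl
toℕ-punchIn (Fin.suc i) (Fin.suc j) = cong suc (toℕ-punchIn i j)

toℕ-punchOut-< : ∀ {m} {i j : Fin (suc m)} (i≢j : i ≢ j) → toℕ j < toℕ i → toℕ (Fin.punchOut i≢j) ≡ toℕ j
toℕ-punchOut-< {suc m} {Fin.suc i} {Fin.zero}  _   _         = refl
toℕ-punchOut-< {suc m} {Fin.suc i} {Fin.suc j} i≢j (s≤s j<i) =
  cong suc (toℕ-punchOut-< (i≢j ∘′ cong Fin.suc) j<i)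

act-posN : ∀ {n} {w : Permutation′ (suc n)} {a} → eval a ≈ w → act (indices a) (posN w) ≡ n
act-posN {n} {w} {a} a≈w = begin
  act (indices a) (posN w)            ≡⟨ toℕ-eval a _ ⟨
  toℕ (eval a ⟨$⟩ʳ (w ⟨$⟩ˡ fromℕ n))  ≡⟨ cong toℕ (trans (a≈w _) (inverseʳ w)) ⟩
  toℕ (fromℕ n)                       ≡⟨ toℕ-fromℕ n ⟩
  n                                   ∎
  where open ≡-Reasoning

-- wbar w keeps every value below n, so on positions it is w read through punchIn (posN w).
wbar-deletion : ∀ {n} {w : Permutation′ (suc n)} {a b} → eval a ≈ w → eval b ≈ wbar w →
                Deletion n (posN w) (indices a) (indices b)
wbar-deletion {n} {w} {a} {b} a≈w b≈w̄ y y<n = begin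
  act (indices b) y                        ≡⟨ cong (act (indices b)) (toℕ-fromℕ< y<n) ⟨
  act (indices b) (toℕ j)                  ≡⟨ toℕ-eval b j ⟨
  toℕ (eval b ⟨$⟩ʳ j)                      ≡⟨ cong toℕ (b≈w̄ j) ⟩
  toℕ (wbar w ⟨$⟩ʳ j)                      ≡⟨ toℕ-punchOut-< _ below-top ⟩
  toℕ (w ⟨$⟩ʳ Fin.punchIn i j)             ≡⟨ cong toℕ (a≈w _) ⟨
  toℕ (eval a ⟨$⟩ʳ Fin.punchIn i j)        ≡⟨ toℕ-eval a _ ⟩
  act (indices a) (toℕ (Fin.punchIn i j))  ≡⟨ cong (act (indices a)) (toℕ-punchIn i j) ⟩
  act (indices a) (punchIn (posN w) (toℕ j))
    ≡⟨ cong (λ x → act (indices a) (punchIn (posN w) x)) (toℕ-fromℕ< y<n) ⟩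
  act (indices a) (punchIn (posN w) y)     ∎
  where
  open ≡-Reasoning
  i : Fin (suc n)
  i = w ⟨$⟩ˡ fromℕ n
  j : Fin n
  j = fromℕ< y<n
  top : toℕ (w ⟨$⟩ʳ i) ≡ n
  top = trans (cong toℕ (inverseʳ w)) (toℕ-fromℕ n)
  below-top : toℕ (w ⟨$⟩ʳ Fin.punchIn i j) < toℕ (w ⟨$⟩ʳ i)
  below-top = subst (toℕ (w ⟨$⟩ʳ Fin.punchIn i j) <_) (sym top) (≤∧≢⇒< (≤-pred (toℕ<n _)) λ eq →
    punchInᵢ≢i i j (trans (sym (inverseˡ w))
      (trans (cong (w ⟨$⟩ˡ_) (toℕ-injective (trans eq (sym top)))) (inverseˡ w))))

lemma4p4 : ∀ (n : ℕ) (w : Permutation′ (suc n)) (a : Word (suc n)) (b : Word n) →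
           Reduced a w → Reduced b (wbar w) →
           repW a ≡ repW b + newrepSize w b
lemma4p4 n w a b ra@(a≈w , _) rb@(b≈w̄ , _) = begin
  length a ∸ suppSize a                ≡⟨ cong₂ _∸_ length-a size-a ⟩
  (ℓb + (n ∸ p)) ∸ ((n ∸ p) + ∣low∣)  ≡⟨ [m+o]∸[o+n]≡m∸[k+n]+k ℓb ∣low∣ (n ∸ p) ∣high∣ high+low≤ℓb ⟩
  ℓb ∸ (∣high∣ + ∣low∣) + ∣high∣       ≡⟨ cong₂ (λ m s → m ∸ s + ∣high∣) (length-map _ b) high+low ⟩
  repW b + newrepSize w b              ∎
  where
  open ≡-Reasoning
  p = posN w
  p≤n : p ≤ n
  p≤n = ≤-pred (toℕ<n (w ⟨$⟩ˡ fromℕ n))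
  open DeleteTopStrand (indices-reduced a {w} ra) (indices-reduced b {wbar w} rb) p≤n
                       (act-posN {w = w} {a} a≈w) (wbar-deletion {w = w} {a} {b} a≈w b≈w̄)
  ℓb = length (indices b)
  ∣high∣ = length (filter (p ≤?_) (suppList b))
  ∣low∣ = length (filter (∁? (p ≤?_)) (suppList b))
  high+low : ∣high∣ + ∣low∣ ≡ suppSize b
  high+low = length-filter-∁ (p ≤?_) (suppList b)
  high+low≤ℓb : ∣high∣ + ∣low∣ ≤ ℓb
  high+low≤ℓb = subst (_≤ ℓb) (sym high+low) (length-deduplicate _≟_ (indices b))
  length-a : length a ≡ ℓb + (n ∸ p)
  length-a = trans (sym (length-map _ a)) length-deleted
  size-a : suppSize a ≡ (n ∸ p) + ∣low∣
  size-a = length-support (indices a) (indices b) p≤n support-deleted
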